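{- Let $X$ be a set of $n$ cards and $a,b,c$ positive integers with $a+b+c=n$ and $a-c=2$. Suppose Alice's $(a,b,c)$-strategy is informative for Bob and weakly $1$-secure against Cathy, and let $\mathcal{A}_i$ be one of its announcements. If $H_A\in\mathcal{A}_i$ and $Y\subset H_A$ with $|Y|=c$, then $\mathcal{P}(Y,i)\neq\emptyset$.
   Context: An $(a,b,c)$-deal is a uniformly random partition of $X$ into Alice's hand $H_A$ ($a$ cards), Bob's hand $H_B$ ($b$ cards) and Cathy's hand $H_C$ ($c$ cards). An announcement is a set of $a$-subsets of $X$. An $(a,b,c)$-strategy consists of announcements $\mathcal{A}_1,\dots,\mathcal{A}_m$ covering all $a$-subsets of $X$ together with, for each $H_A$, a probability distribution $p_{H_A}$ with positive values on $g(H_A)=\{i : H_A\in\mathcal{A}_i\}$; Alice broadcasts an index $i$ chosen according to $p_{H_A}$. For $H\subseteq X$, $\mathcal{P}(H,i)=\{H_A\in\mathcal{A}_i : H_A\cap H=\emptyset\}$. Informative for Bob: $|\mathcal{P}(H_B,i)|\le 1$ for every $b$-subset $H_B$ and every $i$. Weakly $1$-secure against Cathy: for every $i$, every $c$-subset $H_C$ with $\mathcal{P}(H_C,i)\neq\emptyset$ and every $x\in X\setminus H_C$, $0<\Pr[x\in H_A\mid i,H_C]<1$, probability over the deal and Alice's choice. -}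

module Defs where

open import Data.Bool using (Bool; true; false; if_then_else_; not; _∧_)
open import Data.Nat as ℕ using (ℕ; zero; suc)
open import Data.Fin using (Fin)
open import Data.Fin.Subset using (Subset; inside; outside; _∩_; ∣_∣; _∈_; _∉_; Empty)
open import Data.Fin.Subset.Properties using (_∈?_; nonempty?)
open import Data.Vec using ([]; _∷_)
open import Data.List using (List; []; _∷_; map; _++_; foldr; length; filter; concatMap)
open import Data.Product using (Σ; ∃; _×_; _,_)
open import Data.Integer using (+_)
open import Data.Rational using (ℚ; 0ℚ; 1ℚ; _+_; _*_; _<_; _≤_; _÷_; _≟_; ≢-nonZero)
open import Relation.Nullary using (yes; no; ¬_)
open import Relation.Nullary.Decidable using (⌊_⌋)
open import Relation.Binary.PropositionalEquality using (_≡_)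

allSubsets : (n : ℕ) → List (Subset n)
allSubsets zero    = [] ∷ []
allSubsets (suc n) = map (inside ∷_) (allSubsets n) ++ map (outside ∷_) (allSubsets n)

Disjoint : ∀ {n} → Subset n → Subset n → Set
Disjoint S T = Empty (S ∩ T)

disjoint? : ∀ {n} → Subset n → Subset n → Bool
disjoint? S T = not ⌊ nonempty? (S ∩ T) ⌋

Σℚ : ∀ {A : Set} → List A → (A → ℚ) → ℚ
Σℚ xs f = foldr (λ x acc → f x + acc) 0ℚ xs

allFin : (m : ℕ) → List (Fin m)
allFin m = Data.List.tabulate (λ i → i)

-- An (a,b,c)-strategy on X = Fin n with m announcements.
-- ann i S ≡ true  means  S ∈ 𝒜_i ;  prob S i is p_S(i).
record Strategy (n a b c : ℕ) : Set where
  field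
    m    : ℕ
    ann  : Fin m → Subset n → Bool
    prob : Subset n → Fin m → ℚ
    ann-size  : ∀ i S → ann i S ≡ true → ∣ S ∣ ≡ a
    covering  : ∀ S → ∣ S ∣ ≡ a → ∃ λ i → ann i S ≡ true
    prob-pos  : ∀ S → ∣ S ∣ ≡ a → ∀ i → ann i S ≡ true → 0ℚ < prob S i
    prob-zero : ∀ S → ∣ S ∣ ≡ a → ∀ i → ann i S ≡ false → prob S i ≡ 0ℚ
    prob-sum  : ∀ S → ∣ S ∣ ≡ a → Σℚ (allFin m) (prob S) ≡ 1ℚ

module _ {n a b c : ℕ} (σ : Strategy n a b c) where
  open Strategy σ

  InP : Subset n → Fin m → Subset n → Set
  InP H i S = ann i S ≡ true × Disjoint S H

  Informative : Set
  Informative = ∀ (HB : Subset n) → ∣ HB ∣ ≡ b → ∀ i →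
                ∀ S T → InP HB i S → InP HB i T → S ≡ T

  -- Probability model.  A deal is (H_A , H_C) with |H_A| = a, |H_C| = c,
  -- H_A ∩ H_C = ∅ (H_B is the complement, of size b when a+b+c = n);
  -- deals are uniformly distributed.
  validDeal : Subset n → Subset n → Bool
  validDeal S T = ⌊ ∣ S ∣ ℕ.≟ a ⌋ ∧ ⌊ ∣ T ∣ ℕ.≟ c ⌋ ∧ disjoint? S T

  numDeals : ℕ
  numDeals = foldr (λ S acc → foldr (λ T acc' → (if validDeal S T then 1 else 0) ℕ.+ acc') 0 (allSubsets n) ℕ.+ acc)
                   0 (allSubsets n)

  inv : ℕ → ℚ
  inv zero    = 0ℚ
  inv (suc k) = (+ 1) Data.Rational./ suc k

  jointPr : Subset n → Subset n → Fin m → ℚ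
  jointPr S T i = if validDeal S T then inv numDeals * prob S i else 0ℚ

  prIT : Fin m → Subset n → ℚ
  prIT i T = Σℚ (allSubsets n) (λ S → jointPr S T i)

  prXIT : Fin n → Fin m → Subset n → ℚ
  prXIT x i T = Σℚ (allSubsets n) (λ S → if ⌊ x ∈? S ⌋ then jointPr S T i else 0ℚ)

  -- conditional probability (0 by convention when the condition has probability 0)
  condDiv : ℚ → ℚ → ℚ
  condDiv num den with den ≟ 0ℚ
  ... | yes _  = 0ℚ
  ... | no ne = _÷_ num den {{≢-nonZero ne}}

  condPr : Fin n → Fin m → Subset n → ℚ
  condPr x i T = condDiv (prXIT x i T) (prIT i T)

  WeaklySecure : Set
  WeaklySecure = ∀ i (HC : Subset n) → ∣ HC ∣ ≡ c →
                 (∃ λ S → InP HC i S) →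
                 ∀ (x : Fin n) → x ∉ HC →
                 (0ℚ < condPr x i HC) × (condPr x i HC < 1ℚ)

-- Weak security alone already forces every announcement to contain a hand avoiding any given
-- c-set Y.  Start from any H_A ∈ 𝒜_i.  If it meets Y in some y, let Cathy hold a c-set C
-- outside H_A that contains Y ∖ H_A (possible since b ≥ 0, i.e. a + c ≤ n).  Then H_A ∈ 𝒫(C, i)
-- and y ∉ C, so Pr[y ∈ H_A | i, C] < 1 yields H_A' ∈ 𝒜_i disjoint
-- from C with y ∉ H_A'.  As C ⊇ Y ∖ H_A, the set H_A' ∩ Y lies strictly inside H_A ∩ Y, and
-- we descend on |H_A ∩ Y|.
module Submission where

open import Defs
open import Data.Nat using (ℕ; _+_; _<_)
open import Data.Fin using (Fin)
open import Data.Fin.Subset using (Subset; _⊆_; ∣_∣)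
open import Data.Product using (∃; _×_)
open import Relation.Binary.PropositionalEquality using (_≡_)
open import Data.Bool using (true)

open import Data.Nat using (zero; suc; _≤_; _∸_; z≤n; s≤s; s≤s⁻¹; _≤?_) renaming (_≟_ to _≟ℕ_)
open import Data.Nat.Properties using (≤-trans; ≰⇒>; m+n≤o⇒m≤o∸n; +-comm; +-assoc; +-monoʳ-≤; m≤n+m)
open import Data.Nat.Induction using (<-wellFounded)
open import Induction.WellFounded using (Acc; acc)
open import Data.Fin.Subset using (inside; outside; _∩_; ∁; _⊂_; _∈_; _∉_)
open import Data.Fin.Subset.Properties
  using (⊆-refl; s⊆s; out⊆; drop-∷-⊆; p⊆q⇒∣p∣≤∣q∣; p⊂q⇒∣p∣<∣q∣; ∣∁p∣≡n∸∣p∣;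
         x∈p∩q⁺; x∈p∩q⁻; ∣p∩q∣≤∣p∣; x∈∁p⇒x∉p; x∉p⇒x∈∁p; _∈?_; nonempty?; anySubset?)
open import Data.Vec using ([]; _∷_; here)
open import Data.Product using (_,_; proj₁; proj₂)
open import Data.Sum using (_⊎_; inj₁; inj₂)
open import Data.Bool using (false; if_then_else_) renaming (_≟_ to _≟ᵇ_)
open import Data.List.Properties using (foldr-cong)
open import Data.Rational using (0ℚ; 1ℚ; _*_; ≢-nonZero) renaming (_+_ to _+ℚ_; _<_ to _<ℚ_; _≟_ to _≟ℚ_)
open import Data.Rational.Properties using (<-irrefl; *-inverseʳ; *-zeroʳ)
open import Relation.Nullary using (yes; no; ¬_; contradiction)
open import Relation.Nullary.Decidable using (⌊_⌋; _×-dec_; ¬?; decidable-stable)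
open import Relation.Unary using (Decidable)
open import Relation.Binary.PropositionalEquality using (refl; sym; trans; cong; subst)

⊆-interpolate : ∀ {n} {p q : Subset n} {k} → p ⊆ q → ∣ p ∣ ≤ k → k ≤ ∣ q ∣ →
                ∃ λ r → p ⊆ r × r ⊆ q × ∣ r ∣ ≡ k
⊆-interpolate {p = []} {[]} _ z≤n z≤n = [] , ⊆-refl , ⊆-refl , refl
⊆-interpolate {p = inside ∷ p} {outside ∷ q} p⊆q _ _ = contradiction (p⊆q here) λ ()
⊆-interpolate {p = inside ∷ p} {inside ∷ q} p⊆q (s≤s p≤k) (s≤s k≤q)
  with r , p⊆r , r⊆q , ∣r∣≡k ← ⊆-interpolate (drop-∷-⊆ p⊆q) p≤k k≤q
  = inside ∷ r , s⊆s p⊆r , s⊆s r⊆q , cong suc ∣r∣≡k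
⊆-interpolate {p = outside ∷ p} {outside ∷ q} p⊆q p≤k k≤q
  with r , p⊆r , r⊆q , ∣r∣≡k ← ⊆-interpolate (drop-∷-⊆ p⊆q) p≤k k≤q
  = outside ∷ r , s⊆s p⊆r , s⊆s r⊆q , ∣r∣≡k
⊆-interpolate {p = outside ∷ p} {inside ∷ q} {k} p⊆q p≤k k≤1+q with k ≤? ∣ q ∣
... | yes k≤q with r , p⊆r , r⊆q , ∣r∣≡k ← ⊆-interpolate (drop-∷-⊆ p⊆q) p≤k k≤q
  = outside ∷ r , s⊆s p⊆r , out⊆ r⊆q , ∣r∣≡k
⊆-interpolate {p = outside ∷ p} {inside ∷ q} {zero} _ _ _ | no k≰q = contradiction z≤n k≰q
⊆-interpolate {p = outside ∷ p} {inside ∷ q} {suc k} p⊆q _ (s≤s k≤q) | no k≰q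
  with r , p⊆r , r⊆q , ∣r∣≡k ← ⊆-interpolate (drop-∷-⊆ p⊆q)
                                 (≤-trans (p⊆q⇒∣p∣≤∣q∣ (drop-∷-⊆ p⊆q)) (s≤s⁻¹ (≰⇒> k≰q))) k≤q
  = inside ∷ r , out⊆ p⊆r , s⊆s r⊆q , cong suc ∣r∣≡k

module _ {n} {p q : Subset n} where

  ⊆∁⇒∉ : ∀ {x} → q ⊆ ∁ p → x ∈ p → x ∉ q
  ⊆∁⇒∉ q⊆∁p x∈p x∈q = x∈∁p⇒x∉p (q⊆∁p x∈q) x∈p

  ⊆∁⇒Disjoint : q ⊆ ∁ p → Disjoint p q
  ⊆∁⇒Disjoint q⊆∁p (x , x∈p∩q) = let x∈p , x∈q = x∈p∩q⁻ p q x∈p∩q in ⊆∁⇒∉ q⊆∁p x∈p x∈q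

  ∩-⊆-if-Disjoint : ∀ {r s} → Disjoint s q → r ∩ ∁ p ⊆ q → s ∩ r ⊆ p ∩ r
  ∩-⊆-if-Disjoint {r} {s} s∩q-empty r∖p⊆q {x} x∈s∩r with x∈s , x∈r ← x∈p∩q⁻ s r x∈s∩r | x ∈? p
  ... | yes x∈p = x∈p∩q⁺ (x∈p , x∈r)
  ... | no x∉p  = contradiction (x , x∈p∩q⁺ (x∈s , r∖p⊆q (x∈p∩q⁺ (x∈r , x∉p⇒x∈∁p x∉p)))) s∩q-empty

∁-extension : ∀ {n a c} {p q : Subset n} → a + c ≤ n → ∣ p ∣ ≡ a → ∣ q ∣ ≡ c →
              ∃ λ r → q ∩ ∁ p ⊆ r × r ⊆ ∁ p × ∣ r ∣ ≡ c
∁-extension {n} {a} {c} {p} {q} a+c≤n ∣p∣≡a ∣q∣≡c =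
  ⊆-interpolate q∖p⊆∁p (subst (∣ q ∩ ∁ p ∣ ≤_) ∣q∣≡c (∣p∩q∣≤∣p∣ q (∁ p))) c≤∣∁p∣
  where
  q∖p⊆∁p : q ∩ ∁ p ⊆ ∁ p
  q∖p⊆∁p x∈q∖p = proj₂ (x∈p∩q⁻ q (∁ p) x∈q∖p)

  c≤∣∁p∣ : c ≤ ∣ ∁ p ∣
  c≤∣∁p∣ = subst (c ≤_) (sym (trans (∣∁p∣≡n∸∣p∣ p) (cong (n ∸_) ∣p∣≡a)))
                 (m+n≤o⇒m≤o∸n c (subst (_≤ n) (+-comm a c) a+c≤n))

module _ {n a b c : ℕ} (σ : Strategy n a b c) where
  open Strategy σ

  -- The 0 case is condDiv's junk value at a zero denominator.
  condDiv-self : ∀ p → condDiv σ p p ≡ 0ℚ ⊎ condDiv σ p p ≡ 1ℚ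
  condDiv-self p with p ≟ℚ 0ℚ
  ... | yes _  = inj₁ refl
  ... | no p≢0 = inj₂ (*-inverseʳ p {{≢-nonZero p≢0}})

  validDeal-sound : ∀ S T → validDeal σ S T ≡ true → ∣ S ∣ ≡ a × Disjoint S T
  validDeal-sound S T _ with ∣ S ∣ ≟ℕ a | ∣ T ∣ ≟ℕ c | nonempty? (S ∩ T)
  ... | yes ∣S∣≡a | yes _ | no S∩T-empty = ∣S∣≡a , S∩T-empty

  InP? : ∀ C i → Decidable (InP σ C i)
  InP? C i S = (ann i S ≟ᵇ true) ×-dec ¬? (nonempty? (S ∩ C))

  jointPr-∉P : ∀ {C i} S → ¬ InP σ C i S → jointPr σ S C i ≡ 0ℚ
  jointPr-∉P {C} {i} S S∉P with validDeal σ S C in valid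
  ... | false = refl
  ... | true with validDeal-sound S C valid | ann i S in announced
  ...   | _ , disjoint | true  = contradiction (refl , disjoint) S∉P
  ...   | ∣S∣≡a , _    | false = trans (cong (inv σ (numDeals σ) *_) (prob-zero S ∣S∣≡a i announced))
                                       (*-zeroʳ (inv σ (numDeals σ)))

  prXIT-forced : ∀ {C i x} → (∀ S → InP σ C i S → x ∈ S) → prXIT σ x i C ≡ prIT σ i C
  prXIT-forced {C} {i} {x} P∋⇒∋x = foldr-cong (λ S acc → cong (_+ℚ acc) (summand S)) refl (allSubsets n)
    where
    summand : ∀ S → (if ⌊ x ∈? S ⌋ then jointPr σ S C i else 0ℚ) ≡ jointPr σ S C i
    summand S with x ∈? S
    ... | yes _   = refl
    ... | no x∉S = sym (jointPr-∉P S (λ S∈P → x∉S (P∋⇒∋x S S∈P)))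

  condPr-forced : ∀ {C i x} → (∀ S → InP σ C i S → x ∈ S) → condPr σ x i C ≡ 0ℚ ⊎ condPr σ x i C ≡ 1ℚ
  condPr-forced {C} {i} {x} P∋⇒∋x
    rewrite prXIT-forced P∋⇒∋x = condDiv-self (prIT σ i C)

  module _ (secure : WeaklySecure σ) where

    secure⇒avoiding-member : ∀ {C i S x} → ∣ C ∣ ≡ c → InP σ C i S → x ∉ C →
                             ∃ λ S′ → InP σ C i S′ × x ∉ S′
    secure⇒avoiding-member {C} {i} {S} {x} ∣C∣≡c S∈P x∉C
      with anySubset? (λ S′ → InP? C i S′ ×-dec ¬? (x ∈? S′))
    ... | yes found = found
    ... | no none
      with condPr-forced (λ S′ S′∈P → decidable-stable (x ∈? S′) (λ x∉S′ → none (S′ , S′∈P , x∉S′)))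
         | secure i C ∣C∣≡c (S , S∈P) x x∉C
    ...   | inj₁ ≡0 | 0<Pr , _ = contradiction (subst (0ℚ <ℚ_) ≡0 0<Pr) (<-irrefl refl)
    ...   | inj₂ ≡1 | _ , Pr<1 = contradiction (subst (_<ℚ 1ℚ) ≡1 Pr<1) (<-irrefl refl)

    meet-shrinks : a + c ≤ n → ∀ {i Y S y} → ∣ Y ∣ ≡ c → ann i S ≡ true → y ∈ S ∩ Y →
                   ∃ λ S′ → ann i S′ ≡ true × S′ ∩ Y ⊂ S ∩ Y
    meet-shrinks a+c≤n {i} {Y} {S} {y} ∣Y∣≡c S∈𝒜 y∈S∩Y
      with C , Y∖S⊆C , C⊆∁S , ∣C∣≡c ← ∁-extension a+c≤n (ann-size i S S∈𝒜) ∣Y∣≡c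
      with S′ , (S′∈𝒜 , S′∩C-empty) , y∉S′
             ← secure⇒avoiding-member ∣C∣≡c (S∈𝒜 , ⊆∁⇒Disjoint C⊆∁S)
                 (⊆∁⇒∉ C⊆∁S (proj₁ (x∈p∩q⁻ S Y y∈S∩Y)))
      = S′ , S′∈𝒜 , ∩-⊆-if-Disjoint S′∩C-empty Y∖S⊆C , y , y∈S∩Y , y∉S′∩Y
      where y∉S′∩Y = λ y∈S′∩Y → y∉S′ (proj₁ (x∈p∩q⁻ S′ Y y∈S′∩Y))

    member-disjoint-from : a + c ≤ n → ∀ {i Y S} → ∣ Y ∣ ≡ c → ann i S ≡ true →
                           ∃ λ S′ → InP σ Y i S′
    member-disjoint-from a+c≤n {i} {Y} {S} ∣Y∣≡c S∈𝒜 = descend S∈𝒜 (<-wellFounded ∣ S ∩ Y ∣)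
      where
      descend : ∀ {S} → ann i S ≡ true → Acc _<_ ∣ S ∩ Y ∣ → ∃ λ S′ → InP σ Y i S′
      descend {S} S∈𝒜 (acc smaller) with nonempty? (S ∩ Y)
      ... | no S∩Y-empty = S , S∈𝒜 , S∩Y-empty
      ... | yes (_ , y∈S∩Y) with S′ , S′∈𝒜 , S′∩Y⊂S∩Y ← meet-shrinks a+c≤n ∣Y∣≡c S∈𝒜 y∈S∩Y
        = descend S′∈𝒜 (smaller (p⊂q⇒∣p∣<∣q∣ S′∩Y⊂S∩Y))

lemma4 : ∀ (n a b c : ℕ) → 0 < a → 0 < b → 0 < c → a + b + c ≡ n → a ≡ c + 2 →
         (σ : Strategy n a b c) → Informative σ → WeaklySecure σ →
         ∀ (i : Fin (Strategy.m σ)) (HA : Subset n) → Strategy.ann σ i HA ≡ true →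
         ∀ (Y : Subset n) → Y ⊆ HA → ∣ Y ∣ ≡ c →
         ∃ λ S → InP σ Y i S
lemma4 n a b c _ _ _ a+b+c≡n _ σ _ secure i HA HA∈𝒜 Y _ ∣Y∣≡c =
  member-disjoint-from σ secure a+c≤n ∣Y∣≡c HA∈𝒜
  where
  a+c≤n : a + c ≤ n
  a+c≤n = subst (a + c ≤_) (trans (sym (+-assoc a b c)) a+b+c≡n) (+-monoʳ-≤ a (m≤n+m c b))
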